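{- Let $\preceq$ be an entrenchment relation and $\alpha\in\mathcal{L}$. Then: (1) if $U\in\mathcal{B}_{\max}(\alpha)$ then $\mathrm{Cn}(U,\alpha)\in\mathcal{B}^w(\alpha)$; (2) if $U\in\mathcal{B}^w_{\max}(\alpha)$ then $\mathrm{Cn}(U^\alpha)\subseteq\mathrm{Coh}(\alpha)$.
   Context: $\mathcal{L}$ is the set of formulas of a propositional language closed under $\lor,\land,\neg,\to$. $\vdash\subseteq 2^{\mathcal{L}}\times\mathcal{L}$ is a fixed consequence relation including classical propositional logic, compact, satisfying the deduction theorem and disjunction in premises. $\alpha\vdash\beta$ means $\{\alpha\}\vdash\beta$; $\mathrm{Cn}(X)=\{\beta:X\vdash\beta\}$, $\mathrm{Cn}(X,\alpha)=\mathrm{Cn}(X\cup\{\alpha\})$. An entrenchment relation is a binary relation $\preceq$ on $\mathcal{L}$ such that for all $\alpha,\beta,\gamma$: $\alpha\preceq\alpha$; $\alpha\vdash\beta$ and $\beta\preceq\gamma$ imply $\alpha\preceq\gamma$; if $\alpha\vdash\beta$ and $\beta\vdash\alpha$ then $\gamma\preceq\alpha$ iff $\gamma\preceq\beta$. $\mathrm{Coh}(\alpha)=\{\beta:\beta\not\preceq\neg\alpha\}$. $\mathcal{B}(\alpha)$ = deductively closed $U$ ($U=\mathrm{Cn}(U)$) with $U\subseteq\mathrm{Coh}(\alpha)$; $\mathcal{B}_{\max}(\alpha)$ = those $U\in\mathcal{B}(\alpha)$ such that no deductively closed $U'\supsetneq U$ lies in $\mathcal{B}(\alpha)$. For a set $U$,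 $U^\alpha=\{\alpha\to\beta:\beta\in U\}$. $\mathcal{B}^w(\alpha)$ = deductively closed $U$ with $U^\alpha\subseteq\mathrm{Coh}(\alpha)$; $\mathcal{B}^w_{\max}(\alpha)$ = those $U\in\mathcal{B}^w(\alpha)$ such that no deductively closed $V\in\mathcal{B}^w(\alpha)$ has $U^\alpha\subsetneq V^\alpha$. -}

module Defs where

open import Level using (0ℓ)
open import Data.Product using (Σ; ∃; _×_; _,_)
open import Data.List using (List)
open import Data.List.Relation.Unary.All using (All)
import Data.List.Membership.Propositional as LM
open import Relation.Nullary using (¬_)
open import Relation.Binary.PropositionalEquality using (_≡_)
open import Relation.Unary using (Pred; _∈_; _⊆_; _⊂_; _∪_; ｛_｝)

-- A propositional language closed under ∨, ∧, ¬, → together with a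
-- consequence relation ⊢ ⊆ 2^L × L (sets of formulas = predicates).
-- "Includes classical propositional logic" is imposed through a complete
-- set of classical natural-deduction closure rules; compactness, the
-- deduction theorem and disjunction in premises are imposed literally.
record Logic : Set₁ where
  infixr 6 _∨_
  infixr 7 _∧_
  infixr 5 _⇒_
  infix 3 _⊢_
  field
    Form : Set
    _∨_ _∧_ _⇒_ : Form → Form → Form
    ¬′ : Form → Form
    _⊢_ : Pred Form 0ℓ → Form → Set
    reflex : ∀ {X α} → α ∈ X → X ⊢ α
    monotone : ∀ {X Y α} → X ⊆ Y → X ⊢ α → Y ⊢ α
    cut : ∀ {X Y α} → (∀ {β} → β ∈ Y → X ⊢ β) → (X ∪ Y) ⊢ α → X ⊢ α
    compact : ∀ {X α} → X ⊢ α →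
      Σ (List Form) λ L → All (λ β → β ∈ X) L × ((λ β → β LM.∈ L) ⊢ α)
    deduction : ∀ {X α β} → (X ∪ ｛ α ｝) ⊢ β → X ⊢ α ⇒ β
    deduction⁻ : ∀ {X α β} → X ⊢ α ⇒ β → (X ∪ ｛ α ｝) ⊢ β
    disjPrem : ∀ {X α β γ} → (X ∪ ｛ α ｝) ⊢ γ → (X ∪ ｛ β ｝) ⊢ γ →
      (X ∪ ｛ α ∨ β ｝) ⊢ γ
    ∧-intro : ∀ {X α β} → X ⊢ α → X ⊢ β → X ⊢ α ∧ β
    ∧-elimˡ : ∀ {X α β} → X ⊢ α ∧ β → X ⊢ α
    ∧-elimʳ : ∀ {X α β} → X ⊢ α ∧ β → X ⊢ β
    ∨-introˡ : ∀ {X α β} → X ⊢ α → X ⊢ α ∨ β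
    ∨-introʳ : ∀ {X α β} → X ⊢ β → X ⊢ α ∨ β
    ¬-intro : ∀ {X α β} → (X ∪ ｛ α ｝) ⊢ β → (X ∪ ｛ α ｝) ⊢ ¬′ β → X ⊢ ¬′ α
    ¬-elim : ∀ {X α β} → X ⊢ α → X ⊢ ¬′ α → X ⊢ β
    reductio : ∀ {X α β} → (X ∪ ｛ ¬′ α ｝) ⊢ β → (X ∪ ｛ ¬′ α ｝) ⊢ ¬′ β → X ⊢ α

module _ (𝓛 : Logic) where
  open Logic 𝓛

  _⊩_ : Form → Form → Set
  α ⊩ β = ｛ α ｝ ⊢ β

  Cn : Pred Form 0ℓ → Pred Form 0ℓ
  Cn X β = X ⊢ β

  Cn+ : Pred Form 0ℓ → Form → Pred Form 0ℓ
  Cn+ X α = Cn (X ∪ ｛ α ｝)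

  DedClosed : Pred Form 0ℓ → Set
  DedClosed U = (U ⊆ Cn U) × (Cn U ⊆ U)

  record Entrenchment (_≼_ : Form → Form → Set) : Set where
    field
      ≼-refl : ∀ {α} → α ≼ α
      ≼-dom : ∀ {α β γ} → α ⊩ β → β ≼ γ → α ≼ γ
      ≼-equiv : ∀ {α β γ} → α ⊩ β → β ⊩ α → ((γ ≼ α → γ ≼ β) × (γ ≼ β → γ ≼ α))

  module _ (_≼_ : Form → Form → Set) where

    Coh : Form → Pred Form 0ℓ
    Coh α β = ¬ (β ≼ ¬′ α)

    B : Form → Pred (Pred Form 0ℓ) 0ℓ
    B α U = DedClosed U × U ⊆ Coh α

    Bmax : Form → Pred (Pred Form 0ℓ) _
    Bmax α U = B α U ×
      ¬ (Σ (Pred Form 0ℓ) λ U′ → DedClosed U′ × U ⊂ U′ × B α U′)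

    _^_ : Pred Form 0ℓ → Form → Pred Form 0ℓ
    (U ^ α) γ = Σ Form λ β → β ∈ U × γ ≡ (α ⇒ β)

    Bw : Form → Pred (Pred Form 0ℓ) 0ℓ
    Bw α U = DedClosed U × (U ^ α) ⊆ Coh α

    Bwmax : Form → Pred (Pred Form 0ℓ) _
    Bwmax α U = Bw α U ×
      ¬ (Σ (Pred Form 0ℓ) λ V → DedClosed V × Bw α V × (U ^ α) ⊂ (V ^ α))

{-# OPTIONS --safe #-}
module Submission where

open import Defs
open import Data.Product using (_×_; _,_; Σ; proj₁)
open import Data.Sum using (inj₂)
open import Data.List using (List; []; _∷_)
open import Data.List.Relation.Unary.All using (All; []; _∷_)
open import Data.List.Relation.Unary.Any using (here; there)
import Data.List.Membership.Propositional as List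
open import Relation.Binary.PropositionalEquality using (refl)
open import Relation.Unary using (Pred; _∈_; _⊆_; _∪_; ｛_｝)

module Consequence (𝓛 : Logic) where
  open Logic 𝓛

  ⊢-trans : ∀ {X Y γ} → (∀ {β} → β ∈ Y → X ⊢ β) → Y ⊢ γ → X ⊢ γ
  ⊢-trans X⊢Y Y⊢γ = cut X⊢Y (monotone inj₂ Y⊢γ)

  ⊢-trans₁ : ∀ {X φ ψ} → X ⊢ φ → ｛ φ ｝ ⊢ ψ → X ⊢ ψ
  ⊢-trans₁ X⊢φ = ⊢-trans λ { refl → X⊢φ }

  Cn-dedClosed : ∀ X → DedClosed 𝓛 (Cn 𝓛 X)
  Cn-dedClosed X = reflex , ⊢-trans (λ X⊢β → X⊢β)

  ⇒-refl : ∀ {X α} → X ⊢ α ⇒ α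
  ⇒-refl = deduction (reflex (inj₂ refl))

  ⇒-∧-elimˡ : ∀ {α β γ} → ｛ α ⇒ (β ∧ γ) ｝ ⊢ α ⇒ β
  ⇒-∧-elimˡ = deduction (∧-elimˡ (deduction⁻ (reflex refl)))

  ⇒-∧-elimʳ : ∀ {α β γ} → ｛ α ⇒ (β ∧ γ) ｝ ⊢ α ⇒ γ
  ⇒-∧-elimʳ = deduction (∧-elimʳ (deduction⁻ (reflex refl)))

module Coherence (𝓛 : Logic) (_≼_ : Logic.Form 𝓛 → Logic.Form 𝓛 → Set) where
  open Logic 𝓛
  open Consequence 𝓛

  Cn+-^-⊆ : ∀ {U α} → Cn 𝓛 U ⊆ U → _^_ 𝓛 _≼_ (Cn+ 𝓛 U α) α ⊆ U
  Cn+-^-⊆ U-closed (β , U,α⊢β , refl) = U-closed (deduction U,α⊢β)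

  ^-finite-conj : ∀ {U α} → Cn 𝓛 U ⊆ U →
    (L : List Form) → All (_∈ _^_ 𝓛 _≼_ U α) L →
    Σ Form λ β → β ∈ U × (∀ {δ} → δ List.∈ L → ｛ α ⇒ β ｝ ⊢ δ)
  ^-finite-conj {α = α} U-closed [] [] = α ⇒ α , U-closed ⇒-refl , λ ()
  ^-finite-conj {α = α} U-closed (_ ∷ L) ((β , β∈U , refl) ∷ L⊆U^α)
    with ^-finite-conj U-closed L L⊆U^α
  ... | β′ , β′∈U , α⇒β′⊢L =
    β ∧ β′ , U-closed (∧-intro (reflex β∈U) (reflex β′∈U)) , entails
    where
      entails : ∀ {δ} → δ List.∈ ((α ⇒ β) ∷ L) → ｛ α ⇒ (β ∧ β′) ｝ ⊢ δ
      entails (here refl) = ⇒-∧-elimˡ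
      entails (there δ∈L) = ⊢-trans₁ ⇒-∧-elimʳ (α⇒β′⊢L δ∈L)

  Cn-^-single : ∀ {U α γ} → Cn 𝓛 U ⊆ U → γ ∈ Cn 𝓛 (_^_ 𝓛 _≼_ U α) →
    Σ Form λ β → β ∈ U × ｛ α ⇒ β ｝ ⊢ γ
  Cn-^-single U-closed U^α⊢γ with compact U^α⊢γ
  ... | L , L⊆U^α , L⊢γ with ^-finite-conj U-closed L L⊆U^α
  ... | β , β∈U , α⇒β⊢L = β , β∈U , ⊢-trans α⇒β⊢L L⊢γ

  Coh-⊢-closed : Entrenchment 𝓛 _≼_ → ∀ {α φ γ} →
    ｛ φ ｝ ⊢ γ → φ ∈ Coh 𝓛 _≼_ α → γ ∈ Coh 𝓛 _≼_ α
  Coh-⊢-closed E φ⊢γ φ≰¬α γ≼¬α = φ≰¬α (Entrenchment.≼-dom E φ⊢γ γ≼¬α)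

  B⇒Cn+∈Bw : ∀ {α U} → U ∈ B 𝓛 _≼_ α → Cn+ 𝓛 U α ∈ Bw 𝓛 _≼_ α
  B⇒Cn+∈Bw {α} {U} ((_ , U-closed) , U⊆Coh) =
    Cn-dedClosed (U ∪ ｛ α ｝) , λ α⇒β∈ → U⊆Coh (Cn+-^-⊆ U-closed α⇒β∈)

  Bw⇒Cn-^⊆Coh : Entrenchment 𝓛 _≼_ → ∀ {α U} →
    U ∈ Bw 𝓛 _≼_ α → Cn 𝓛 (_^_ 𝓛 _≼_ U α) ⊆ Coh 𝓛 _≼_ α
  Bw⇒Cn-^⊆Coh E ((_ , U-closed) , U^α⊆Coh) U^α⊢γ with Cn-^-single U-closed U^α⊢γ
  ... | β , β∈U , α⇒β⊢γ = Coh-⊢-closed E α⇒β⊢γ (U^α⊆Coh (β , β∈U , refl))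

mainTheorem4 : (𝓛 : Logic) → let open Logic 𝓛 in
    (_≼_ : Form → Form → Set) → Entrenchment 𝓛 _≼_ → (α : Form) →
      ((U : Pred Form _) → U ∈ Bmax 𝓛 _≼_ α → Cn+ 𝓛 U α ∈ Bw 𝓛 _≼_ α)
      × ((U : Pred Form _) → U ∈ Bwmax 𝓛 _≼_ α → Cn 𝓛 (_^_ 𝓛 _≼_ U α) ⊆ Coh 𝓛 _≼_ α)
mainTheorem4 𝓛 _≼_ E α =
  (λ U U∈Bmax → B⇒Cn+∈Bw (proj₁ U∈Bmax)) ,
  (λ U U∈Bwmax → Bw⇒Cn-^⊆Coh E (proj₁ U∈Bwmax))
  where open Coherence 𝓛 _≼_
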